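{- Let $\mathbf{C}$ be a presheaf topos and $v:A\to B$ an arrow. 1. Let $c\in\mathrm{AC}(A)$ and let $\mathcal{F}$ be a forward root shifter for $v$ that is defined on $c$. Then for every arrow $g:B\to G$, $v;g\models c$ implies $g\models\mathcal{F}(c)$. 2. Let $c\in\mathrm{AC}(B)$ and let $\mathcal{B}$ be a backward root shifter for $v$ that is defined on $c$. Then for every arrow $g:B\to G$, $v;g\models\mathcal{B}(c)$ implies $g\models c$.
   Context: Composition is written in diagrammatic order: $f;g$ is $f$ followed by $g$. Ab-conditions. For an object $R$, the sets $\mathrm{AC}(R)$ (ab-conditions) and $\mathrm{AB}(R)$ (ab-branches) are the smallest sets such that: - $c=(R,p_1\cdots p_w)\in\mathrm{AC}(R)$ for $w\ge0$ and $p_i\in\mathrm{AB}(R)$; - $(a,c')\in\mathrm{AB}(R)$ for an arrow $a:R\to P$ and $c'\in\mathrm{AC}(P)$. We write $|c|=w$ and $p^c_i=(a^c_i,c_i)$, with $a^c_i:R\to P^c_i$. Satisfaction. $g:R\to G$ satisfies $c$ (written $g\models c$) iff there are $i$ and $h:P^c_i\to G$ with $g=a^c_i;h$ and $h\not\models c_i$. Source shifters. A source shifter from $X$ to $Y$ is a family of maps $\mathcal{S}_Z:\mathbf{C}(X,Z)\to\mathbf{C}(Y,Z)$ with $\mathcal{S}(a;t)=\mathcal{S}(a);t$. - A forward source shifter for $v:A\to B$ is a source shifter from $A$ to $B$ such that $v;g=a;h$ implies $g=\mathcal{S}(a);h$, for all $a:A\to C$, $g:B\to G$, $h:C\to G$.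 - A backward source shifter for $v$ is a source shifter from $B$ to $A$ such that $v;g=\mathcal{S}(a);h$ implies $g=a;h$, for all $a:B\to C$, $g:B\to G$, $h:C\to G$. Root shifters. A source shifter $\mathcal{S}$ from $X$ to $Y$ induces $\bar{\mathcal{S}}:c\mapsto(Y,(\mathcal{S}(a^c_1),c_1)\cdots(\mathcal{S}(a^c_{|c|}),c_{|c|}))$. The trivial root shifter $\mathcal{I}_{X,Y}$ is defined only on zero-width conditions, by $(X,\epsilon)\mapsto(Y,\epsilon)$. - A forward root shifter for $v$ is $\bar{\mathcal{F}}$ for a forward source shifter $\mathcal{F}$ for $v$, or $\mathcal{I}_{A,B}$. - A backward root shifter for $v$ is $\bar{\mathcal{B}}$ for a backward source shifter $\mathcal{B}$ for $v$, or $\mathcal{I}_{B,A}$. -}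

module Defs where

open import Level using (Level; _⊔_; suc)
open import Data.Nat using (ℕ; zero)
open import Data.Fin using (Fin)
open import Data.Product using (Σ; _×_; _,_)
open import Data.Unit.Polymorphic using (⊤)
open import Relation.Nullary using (¬_)
open import Relation.Binary using (IsEquivalence)
open import Relation.Binary.PropositionalEquality as ≡ using (_≡_; refl)

-- Categories (composition in diagrammatic order: f ⨾ g is f then g),
-- with setoid-valued hom-sets.

record Category (o ℓ e : Level) : Set (suc (o ⊔ ℓ ⊔ e)) where
  infixr 9 _⨾_
  infix  4 _≈_
  field
    Obj   : Set o
    Hom   : Obj → Obj → Set ℓ
    _≈_   : ∀ {X Y} → Hom X Y → Hom X Y → Set e
    ≈-equiv : ∀ {X Y} → IsEquivalence (_≈_ {X} {Y})
    id    : ∀ {X} → Hom X X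
    _⨾_   : ∀ {X Y Z} → Hom X Y → Hom Y Z → Hom X Z
    ⨾-cong : ∀ {X Y Z} {f f' : Hom X Y} {g g' : Hom Y Z} →
             f ≈ f' → g ≈ g' → (f ⨾ g) ≈ (f' ⨾ g')
    assoc : ∀ {W X Y Z} (f : Hom W X) (g : Hom X Y) (h : Hom Y Z) →
            ((f ⨾ g) ⨾ h) ≈ (f ⨾ (g ⨾ h))
    idˡ   : ∀ {X Y} (f : Hom X Y) → (id ⨾ f) ≈ f
    idʳ   : ∀ {X Y} (f : Hom X Y) → (f ⨾ id) ≈ f

module _ {o ℓ e : Level} (C : Category o ℓ e) (p : Level) where
  private module C = Category C

  record Presheaf : Set (o ⊔ ℓ ⊔ e ⊔ suc p) where
    field
      F₀     : C.Obj → Set p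
      F₁     : ∀ {X Y} → C.Hom X Y → F₀ Y → F₀ X
      F-id   : ∀ {X} (x : F₀ X) → F₁ C.id x ≡ x
      F-comp : ∀ {X Y Z} (f : C.Hom X Y) (g : C.Hom Y Z) (x : F₀ Z) →
               F₁ (f C.⨾ g) x ≡ F₁ f (F₁ g x)
      F-resp : ∀ {X Y} {f g : C.Hom X Y} → f C.≈ g → (x : F₀ Y) → F₁ f x ≡ F₁ g x

  open Presheaf

  record NatTrans (P Q : Presheaf) : Set (o ⊔ ℓ ⊔ p) where
    field
      η       : ∀ X → F₀ P X → F₀ Q X
      natural : ∀ {X Y} (f : C.Hom X Y) (x : F₀ P Y) →
                η X (F₁ P f x) ≡ F₁ Q f (η Y x)

  open NatTrans

  PSh : Category (o ⊔ ℓ ⊔ e ⊔ suc p) (o ⊔ ℓ ⊔ p) (o ⊔ p)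
  PSh = record
    { Obj = Presheaf
    ; Hom = NatTrans
    ; _≈_ = λ α β → ∀ X x → η α X x ≡ η β X x
    ; ≈-equiv = record
        { refl  = λ X x → refl
        ; sym   = λ eq X x → ≡.sym (eq X x)
        ; trans = λ eq eq' X x → ≡.trans (eq X x) (eq' X x) }
    ; id = record { η = λ X x → x ; natural = λ f x → refl }
    ; _⨾_ = λ α β → record
        { η = λ X x → η β X (η α X x)
        ; natural = λ f x → ≡.trans (≡.cong (η β _) (natural α f x)) (natural β f (η α _ x)) }
    ; ⨾-cong = λ {_} {_} {_} {f} {f'} {g} {g'} eq eq' X x →
        ≡.trans (≡.cong (η g X) (eq X x)) (eq' X (η f' X x))
    ; assoc = λ f g h X x → refl
    ; idˡ = λ f X x → refl
    ; idʳ = λ f X x → refl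
    }

module Conditions {o ℓ e : Level} (𝒞 : Category o ℓ e) where
  open Category 𝒞

  -- AC R : ab-conditions at R ⨾ AB R : ab-branches at R.
  -- A condition (R, p₁ ⋯ p_w) is given by its width w and branches.
  data AC (R : Obj) : Set (o ⊔ ℓ)
  data AB (R : Obj) : Set (o ⊔ ℓ)

  data AC R where
    cond : (w : ℕ) → (Fin w → AB R) → AC R

  data AB R where
    branch : ∀ {P} → Hom R P → AC P → AB R

  width : ∀ {R} → AC R → ℕ
  width (cond w _) = w

  infix 4 _⊨_ _⊨ᵇ_
  _⊨_  : ∀ {R G} → Hom R G → AC R → Set (o ⊔ ℓ ⊔ e)
  _⊨ᵇ_ : ∀ {R G} → Hom R G → AB R → Set (o ⊔ ℓ ⊔ e)
  g ⊨ cond w ps = Σ (Fin w) λ i → g ⊨ᵇ ps i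
  _⊨ᵇ_ {G = G} g (branch {P} a c′) = Σ (Hom P G) λ h → (g ≈ (a ⨾ h)) × ¬ (h ⊨ c′)

  record SourceShifter (X Y : Obj) : Set (o ⊔ ℓ ⊔ e) where
    field
      S      : ∀ {Z} → Hom X Z → Hom Y Z
      S-cong : ∀ {Z} {a a′ : Hom X Z} → a ≈ a′ → S a ≈ S a′
      S-⨾    : ∀ {Z Z′} (a : Hom X Z) (t : Hom Z Z′) → S (a ⨾ t) ≈ (S a ⨾ t)
  open SourceShifter public

  IsForwardSourceShifter : ∀ {A B} (v : Hom A B) → SourceShifter A B → Set (o ⊔ ℓ ⊔ e)
  IsForwardSourceShifter {A} {B} v 𝒮 =
    ∀ {C G} (a : Hom A C) (g : Hom B G) (h : Hom C G) →
      (v ⨾ g) ≈ (a ⨾ h) → g ≈ (S 𝒮 a ⨾ h)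

  IsBackwardSourceShifter : ∀ {A B} (v : Hom A B) → SourceShifter B A → Set (o ⊔ ℓ ⊔ e)
  IsBackwardSourceShifter {A} {B} v 𝒮 =
    ∀ {C G} (a : Hom B C) (g : Hom B G) (h : Hom C G) →
      (v ⨾ g) ≈ (S 𝒮 a ⨾ h) → g ≈ (a ⨾ h)

  -- root shifters from X to Y: either induced by a source shifter (S̄),
  -- or the trivial root shifter I_{X,Y} (defined only on width 0).
  data RootShifter (X Y : Obj) : Set (o ⊔ ℓ ⊔ e) where
    induced : SourceShifter X Y → RootShifter X Y
    trivial : RootShifter X Y

  DefinedOn : ∀ {X Y} → RootShifter X Y → AC X → Set
  DefinedOn (induced _) c = ⊤
  DefinedOn trivial     c = width c ≡ 0

  applyRS : ∀ {X Y} (ℛ : RootShifter X Y) (c : AC X) → DefinedOn ℛ c → AC Y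
  applyRS (induced 𝒮) (cond w ps) _ = cond w λ i → shiftBranch (ps i)
    where
      shiftBranch : AB _ → AB _
      shiftBranch (branch a c′) = branch (S 𝒮 a) c′
  applyRS trivial (cond w ps) _ = cond 0 λ ()

  IsForwardRootShifter : ∀ {A B} (v : Hom A B) → RootShifter A B → Set (o ⊔ ℓ ⊔ e)
  IsForwardRootShifter v (induced 𝒮) = IsForwardSourceShifter v 𝒮
  IsForwardRootShifter v trivial     = ⊤

  IsBackwardRootShifter : ∀ {A B} (v : Hom A B) → RootShifter B A → Set (o ⊔ ℓ ⊔ e)
  IsBackwardRootShifter v (induced 𝒮) = IsBackwardSourceShifter v 𝒮
  IsBackwardRootShifter v trivial     = ⊤

{-# OPTIONS --safe #-}
module Submission where

-- Satisfaction is witnessed branch by branch, and the shifter property is exactly what turns a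
-- factorisation v ⨾ g ≈ a ⨾ h into g ≈ S a ⨾ h (forward), resp. v ⨾ g ≈ S a ⨾ h into g ≈ a ⨾ h
-- (backward), with the same h, so the same negated subcondition still applies. The trivial root
-- shifter only acts on, and only produces, width-zero conditions, which nothing satisfies. No
-- property of presheaf toposes is needed: the argument works in any category.

open import Defs
open import Level using (Level)
open import Data.Product using (_×_; _,_)
open import Data.Fin using (Fin)
open import Data.Empty using (⊥-elim)
open import Relation.Nullary using (¬_)
open import Relation.Binary.PropositionalEquality using (_≡_; refl)

module ShiftedSatisfaction {o ℓ e : Level} (𝒞 : Category o ℓ e) where
  open Category 𝒞
  open Conditions 𝒞

  branches : ∀ {R} (c : AC R) → Fin (width c) → AB R
  branches (cond w ps) = ps

  ⊨-width-zero : ∀ {R G} {g : Hom R G} {c : AC R} → width c ≡ 0 → ¬ (g ⊨ c)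
  ⊨-width-zero {c = cond 0 ps} refl (() , _)

  ⊨ᵇ-branch-transfer : ∀ {R R′ P G} {f : Hom R G} {g : Hom R′ G} {a : Hom R P} {b : Hom R′ P}
                       {c′ : AC P} → (∀ h → f ≈ a ⨾ h → g ≈ b ⨾ h) →
                       f ⊨ᵇ branch a c′ → g ⊨ᵇ branch b c′
  ⊨ᵇ-branch-transfer factor (h , f≈a⨾h , h⊭c′) = h , factor h f≈a⨾h , h⊭c′

  module _ {A B : Obj} (v : Hom A B) where

    forward-induced-⊨ : ∀ {𝒮} → IsForwardSourceShifter v 𝒮 → (c : AC A) → ∀ {G} (g : Hom B G) →
                        (v ⨾ g) ⊨ c → g ⊨ applyRS (induced 𝒮) c _
    forward-induced-⊨ {𝒮} isF (cond w ps) g (i , sat) = i , shiftedBranch i sat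
      where
        shiftedBranch : ∀ i → (v ⨾ g) ⊨ᵇ ps i →
                        g ⊨ᵇ branches (applyRS (induced 𝒮) (cond w ps) _) i
        shiftedBranch i with ps i
        ... | branch a c′ = ⊨ᵇ-branch-transfer (isF a g)

    backward-induced-⊨ : ∀ {𝒮} → IsBackwardSourceShifter v 𝒮 → (c : AC B) → ∀ {G} (g : Hom B G) →
                         (v ⨾ g) ⊨ applyRS (induced 𝒮) c _ → g ⊨ c
    backward-induced-⊨ {𝒮} isB (cond w ps) g (i , sat) = i , unshiftedBranch i sat
      where
        unshiftedBranch : ∀ i → (v ⨾ g) ⊨ᵇ branches (applyRS (induced 𝒮) (cond w ps) _) i →
                          g ⊨ᵇ ps i
        unshiftedBranch i with ps i
        ... | branch a c′ = ⊨ᵇ-branch-transfer (isB a g)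

    forward-root-⊨ : (c : AC A) (ℱ : RootShifter A B) → IsForwardRootShifter v ℱ →
                     (d : DefinedOn ℱ c) → ∀ {G} (g : Hom B G) →
                     (v ⨾ g) ⊨ c → g ⊨ applyRS ℱ c d
    forward-root-⊨ c (induced 𝒮) isF _ g = forward-induced-⊨ isF c g
    forward-root-⊨ c trivial     _   w≡0 g sat = ⊥-elim (⊨-width-zero w≡0 sat)

    backward-root-⊨ : (c : AC B) (ℬ : RootShifter B A) → IsBackwardRootShifter v ℬ →
                      (d : DefinedOn ℬ c) → ∀ {G} (g : Hom B G) →
                      (v ⨾ g) ⊨ applyRS ℬ c d → g ⊨ c
    backward-root-⊨ c           (induced 𝒮) isB _ g = backward-induced-⊨ isB c g
    backward-root-⊨ (cond _ _)  trivial     _   _ g sat = ⊥-elim (⊨-width-zero refl sat)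

proposition2 : ∀ {o ℓ e : Level} (C : Category o ℓ e) (p : Level) →
    let open Category (PSh C p) in
    let open Conditions (PSh C p) in
    ∀ {A B : Obj} (v : Hom A B) →
      (∀ (c : AC A) (ℱ : RootShifter A B) → IsForwardRootShifter v ℱ →
        (d : DefinedOn ℱ c) → ∀ {G} (g : Hom B G) →
        (v ⨾ g) ⊨ c → g ⊨ applyRS ℱ c d)
      ×
      (∀ (c : AC B) (ℬ : RootShifter B A) → IsBackwardRootShifter v ℬ →
        (d : DefinedOn ℬ c) → ∀ {G} (g : Hom B G) →
        (v ⨾ g) ⊨ applyRS ℬ c d → g ⊨ c)
proposition2 C p v = forward-root-⊨ v , backward-root-⊨ v
  where open ShiftedSatisfaction (PSh C p)
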